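{- Let $n\ge1$. Then for each $m\le n$ and for any $2m$-element subalgebra $\mathbf{A}$ of $\mathbf{Z}_{2n}$ there exists $\varphi_{\mathbf{A}}\in F_n$ such that $\varphi_{\mathbf{A}}\restriction_{\mathbf{A}}$ is an isomorphism from $\mathbf{A}$ onto $\mathbf{Z}_{2m}$. Moreover, $\varphi_{\mathbf{A}}^{ -1}$ also belongs to $F_n$.
   Context: $\mathbf{Z}_{2n}$ is the Sugihara algebra on $\{ -n,\ldots,n\}\setminus\{0\}$ (lattice order of integers, $\neg a=-a$, $a\to b=(-a)\vee b$ if $a\le b$, $(-a)\wedge b$ otherwise), and $\mathbf{Z}_{2m}$ its subalgebra on $\{ -m,\ldots,m\}\setminus\{0\}$. Partial endomorphisms of $\mathbf{Z}_{2n}$ are homomorphisms from a subalgebra of $\mathbf{Z}_{2n}$ into $\mathbf{Z}_{2n}$; they form a monoid under composition once the empty map is added. For $1<i\le n$, $f_i$ is the partial endomorphism with domain $\mathbf{Z}_{2n}\setminus\{i,-i\}$ sending $i-1\mapsto i$, $-(i-1)\mapsto -i$ and fixing all other elements; $g$ is the partial endomorphism with domain $\mathbf{Z}_{2n}\setminus\{1,-1\}$, $g(a)=a-1$ if $a>0$, $g(a)=a+1$ otherwise. $F_n$ is the submonoid of the partial endomorphism monoid of $\mathbf{Z}_{2n}$ generated by $f_2,\ldots,f_n,g$. -}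

module Defs where

open import Data.Nat as ℕ using (ℕ; zero; suc)
open import Data.Integer using (ℤ; +_; -_; _⊓_; _⊔_; ∣_∣; _<_; _≤_) renaming (_+_ to _+ℤ_; _-_ to _-ℤ_)
import Data.Integer.Properties as ℤP
import Data.Nat.Properties as ℕP
open import Data.Bool using (Bool; true; false; if_then_else_; _∧_; not)
open import Data.Maybe using (Maybe; just; nothing; _>>=_)
open import Data.List using (List; []; _∷_; length; foldr)
open import Data.List.Membership.Propositional using (_∈_)
open import Data.List.Relation.Unary.All using (All)
open import Data.List.Relation.Unary.Unique.Propositional using (Unique)
open import Data.Product using (Σ; ∃; _×_; _,_)
open import Relation.Nullary using (¬_; does)
open import Relation.Binary.PropositionalEquality using (_≡_; _≢_)

-- The Sugihara algebra Z_{2n}: carrier {-n,…,n} \ {0} ⊆ ℤ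

InZ : ℕ → ℤ → Set
InZ n a = (a ≢ + 0) × (∣ a ∣ ℕ.≤ n)

inZ : ℕ → ℤ → Bool
inZ n a = not (does (a ℤP.≟ + 0)) ∧ does (∣ a ∣ ℕP.≤? n)

_∧ˢ_ : ℤ → ℤ → ℤ
a ∧ˢ b = a ⊓ b

_∨ˢ_ : ℤ → ℤ → ℤ
a ∨ˢ b = a ⊔ b

¬ˢ_ : ℤ → ℤ
¬ˢ a = - a

_⇒ˢ_ : ℤ → ℤ → ℤ
a ⇒ˢ b = if does (a ℤP.≤? b) then (- a) ⊔ b else (- a) ⊓ b

record Subalgebra (n k : ℕ) : Set where
  field
    carrier  : List ℤ
    unique   : Unique carrier
    size     : length carrier ≡ k
    inside   : All (InZ n) carrier
    closed-∧ : ∀ {a b} → a ∈ carrier → b ∈ carrier → (a ∧ˢ b) ∈ carrier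
    closed-∨ : ∀ {a b} → a ∈ carrier → b ∈ carrier → (a ∨ˢ b) ∈ carrier
    closed-¬ : ∀ {a} → a ∈ carrier → (¬ˢ a) ∈ carrier
    closed-⇒ : ∀ {a b} → a ∈ carrier → b ∈ carrier → (a ⇒ˢ b) ∈ carrier

PMap : Set
PMap = ℤ → Maybe ℤ

_∘ₚ_ : PMap → PMap → PMap
(ψ ∘ₚ φ) a = φ a >>= ψ

idZ : ℕ → PMap
idZ n a = if inZ n a then just a else nothing

fMap : ℕ → ℕ → PMap
fMap n i a =
  if not (inZ n a) then nothing
  else if does (∣ a ∣ ℕ.≟ i) then nothing
  else if does (a ℤP.≟ + (i ℕ.∸ 1)) then just (+ i)
  else if does (a ℤP.≟ - + (i ℕ.∸ 1)) then just (- + i)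
  else just a

gMap : ℕ → PMap
gMap n a =
  if not (inZ n a) then nothing
  else if does (∣ a ∣ ℕ.≟ 1) then nothing
  else if does (+ 0 ℤP.<? a) then just (a -ℤ + 1)
  else just (a +ℤ + 1)

data Gen (n : ℕ) : Set where
  f : (i : ℕ) → 1 ℕ.< i → i ℕ.≤ n → Gen n
  g : Gen n

genMap : {n : ℕ} → Gen n → PMap
genMap {n} (f i _ _) = fMap n i
genMap {n} g         = gMap n

evalWord : (n : ℕ) → List (Gen n) → PMap
evalWord n []       = idZ n
evalWord n (x ∷ xs) = genMap x ∘ₚ evalWord n xs

InF : ℕ → PMap → Set
InF n φ = Σ (List (Gen n)) λ w → ∀ a → evalWord n w a ≡ φ a

record IsoOnto {n k : ℕ} (m : ℕ) (φ : PMap) (A : Subalgebra n k) : Set where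
  open Subalgebra A
  field
    total : ∀ {a} → a ∈ carrier → Σ ℤ λ b → (φ a ≡ just b) × InZ m b
    injective : ∀ {a a' b} → a ∈ carrier → a' ∈ carrier →
                φ a ≡ just b → φ a' ≡ just b → a ≡ a'
    surjective : ∀ {b} → InZ m b → Σ ℤ λ a → (a ∈ carrier) × (φ a ≡ just b)
    hom-∧ : ∀ {a b x y} → a ∈ carrier → b ∈ carrier → φ a ≡ just x → φ b ≡ just y →
            φ (a ∧ˢ b) ≡ just (x ∧ˢ y)
    hom-∨ : ∀ {a b x y} → a ∈ carrier → b ∈ carrier → φ a ≡ just x → φ b ≡ just y →
            φ (a ∨ˢ b) ≡ just (x ∨ˢ y)
    hom-¬ : ∀ {a x} → a ∈ carrier → φ a ≡ just x → φ (¬ˢ a) ≡ just (¬ˢ x)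
    hom-⇒ : ∀ {a b x y} → a ∈ carrier → b ∈ carrier → φ a ≡ just x → φ b ≡ just y →
            φ (a ⇒ˢ b) ≡ just (x ⇒ˢ y)

IsInverse : PMap → PMap → Set
IsInverse ψ φ = ∀ a b → (ψ b ≡ just a → φ a ≡ just b) × (φ a ≡ just b → ψ b ≡ just a)

-- All maps involved are odd, so they are determined by their action on the
-- positive half {1,…,n}, written as partial maps of ℕ with k standing for k+1
-- ("half maps"; `lift` turns a half map back into a map of Z_{2n}).  In this
-- picture g is the deletion of 0 and f_{j+2} pushes j up onto j+1.  The proof:
--   1. words of generators act on [0,n) by composing the unrestricted
--      generator half maps, and this commutes with `lift`;
--   2. the maps realised in F_n together with an inverse realised in F_n
--      ("invertible" maps) are closed under composition;
--   3. deleting a point x < n and closing the gap is invertible: it is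
--      g f_2 ⋯ f_{x+1}, with inverse f_{x+2} ⋯ f_{n} (or itself when x = n-1);
--   4. for any set S ⊆ ℕ, deleting in turn every point below n outside S
--      ("compression") is invertible and sends each k ∈ S to its rank in S;
--   5. compression along the positive half of a subalgebra A is, on A, an
--      order embedding commuting with negation onto Z_{2·rank}; such maps are
--      homomorphisms of Sugihara algebras, and counting gives rank = m.

module Submission where

open import Defs
open import Data.Nat as ℕ using (ℕ; zero; suc; _+_; _*_; _<ᵇ_; _≡ᵇ_; _<_; _≤_; z≤n; s≤s)
import Data.Nat.Properties as ℕP
open import Data.Integer as ℤ using (ℤ; +_; -[1+_]; -_; -≤-; -≤+; +≤+)
import Data.Integer.Properties as ℤP
open import Data.Bool using (Bool; true; false; if_then_else_)
open import Data.Bool.Properties using (T-≡)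
open import Data.Maybe as M using (Maybe; just; nothing; _>>=_)
open import Data.Maybe.Properties using (just-injective)
open import Data.List using (List; []; _∷_; _++_; length)
open import Data.List.Membership.Propositional using (_∈_)
open import Data.List.Membership.Propositional.Properties.WithK using (unique∧set⇒bag)
open import Data.List.Membership.DecPropositional ℤP._≟_ using (_∈?_)
open import Data.List.Relation.Unary.Any using (here; there)
open import Data.List.Relation.Unary.All as All using ()
open import Data.List.Relation.Unary.AllPairs using ([]; _∷_)
open import Data.List.Relation.Unary.Unique.Propositional using (Unique)
open import Data.List.Relation.Binary.BagAndSetEquality using (∼bag⇒↭)
open import Data.List.Relation.Binary.Permutation.Propositional.Properties using (↭-length)
open import Data.Product using (Σ; _×_; _,_; proj₁; proj₂)
open import Data.Sum using (_⊎_; inj₁; inj₂)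
open import Data.Empty using (⊥-elim)
open import Function.Bundles using (mk⇔; Equivalence)
open import Relation.Binary using (tri<; tri≈; tri>)
open import Relation.Nullary using (yes; no; does)
open import Relation.Binary.PropositionalEquality

-- A partial map of ℕ; as the positive half of an odd partial map of ℤ, the
-- index k stands for the integer + suc k.
HalfMap : Set
HalfMap = ℕ → Maybe ℕ

_∘ₕ_ : HalfMap → HalfMap → HalfMap
(q ∘ₕ p) k = p k >>= q

restrict : ℕ → HalfMap → HalfMap
restrict n p k = if k <ᵇ n then p k else nothing

shift : HalfMap → HalfMap
shift p zero    = just zero
shift p (suc k) = M.map suc (p k)

lift : HalfMap → PMap
lift p (+ zero)  = nothing
lift p (+ suc k) = M.map (λ r → + suc r) (p k)
lift p -[1+ k ]  = M.map -[1+_] (p k)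

Bounded : ℕ → HalfMap → Set
Bounded n p = ∀ {k r} → k < n → p k ≡ just r → r < n

HalfInverse : HalfMap → HalfMap → Set
HalfInverse q p = ∀ k l → (q l ≡ just k → p k ≡ just l) × (p k ≡ just l → q l ≡ just k)

bind-cong : ∀ {A B : Set} (m : Maybe A) {h h' : A → Maybe B} →
            (∀ a → h a ≡ h' a) → (m >>= h) ≡ (m >>= h')
bind-cong nothing  e = refl
bind-cong (just a) e = e a

map-just : ∀ {A B : Set} {h : A → B} (m : Maybe A) {b} →
           M.map h m ≡ just b → Σ A λ a → (m ≡ just a) × (h a ≡ b)
map-just (just a) refl = a , refl , refl

restrict-in : ∀ {n k} p → k < n → restrict n p k ≡ p k
restrict-in {n} {k} p k<n rewrite Equivalence.to T-≡ (ℕP.<⇒<ᵇ k<n) = refl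

restrict-out : ∀ {n k} p → n ≤ k → restrict n p k ≡ nothing
restrict-out {n} {k} p n≤k with k <ᵇ n in e
... | false = refl
... | true  = ⊥-elim (ℕP.<⇒≱ (ℕP.<ᵇ⇒< k n (Equivalence.from T-≡ e)) n≤k)

restrict-just : ∀ {n k r} p → restrict n p k ≡ just r → k < n × p k ≡ just r
restrict-just {n} {k} p e with k <ᵇ n in lt
... | true = ℕP.<ᵇ⇒< k n (Equivalence.from T-≡ lt) , e

restrict-cong : ∀ n {p q} → p ≗ q → restrict n p ≗ restrict n q
restrict-cong n e k = cong (if k <ᵇ n then_else nothing) (e k)

restrict-∘ : ∀ n q p → Bounded n p → (restrict n q ∘ₕ restrict n p) ≗ restrict n (q ∘ₕ p)
restrict-∘ n q p bounded k with k ℕ.<? n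
... | no k≮n rewrite restrict-out p (ℕP.≮⇒≥ k≮n) | restrict-out (q ∘ₕ p) (ℕP.≮⇒≥ k≮n) = refl
... | yes k<n rewrite restrict-in p k<n | restrict-in (q ∘ₕ p) k<n with p k in e
...   | nothing = refl
...   | just r  = restrict-in q (bounded k<n e)

restrict-top : ∀ N p q → (∀ {k} → k < N → p k ≡ q k) → p N ≡ nothing →
               restrict (suc N) p ≗ restrict N q
restrict-top N p q below top k with ℕP.<-cmp k N
... | tri< k<N _ _ = trans (restrict-in p (ℕP.m<n⇒m<1+n k<N))
                           (trans (below k<N) (sym (restrict-in q k<N)))
... | tri≈ _ refl _ = trans (restrict-in p (ℕP.n<1+n k)) (trans top (sym (restrict-out q ℕP.≤-refl)))
... | tri> _ _ N<k = trans (restrict-out p N<k) (sym (restrict-out q (ℕP.<⇒≤ N<k)))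

restrict-inverse : ∀ {q p} m n → HalfInverse q p →
                   (∀ {k l} → p k ≡ just l → (k < n → l < m) × (l < m → k < n)) →
                   HalfInverse (restrict m q) (restrict n p)
restrict-inverse {q} {p} m n inv range k l = to , from
  where
  to : restrict m q l ≡ just k → restrict n p k ≡ just l
  to e with restrict-just q e
  ... | l<m , e' = let pk = proj₁ (inv k l) e' in trans (restrict-in p (proj₂ (range pk) l<m)) pk
  from : restrict n p k ≡ just l → restrict m q l ≡ just k
  from e with restrict-just p e
  ... | k<n , e' = trans (restrict-in q (proj₁ (range e') k<n)) (proj₂ (inv k l) e')

shift-cong : ∀ {p q} → p ≗ q → shift p ≗ shift q
shift-cong e zero    = refl
shift-cong e (suc k) = cong (M.map suc) (e k)

shift-∘ : ∀ q p → (shift q ∘ₕ shift p) ≗ shift (q ∘ₕ p)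
shift-∘ q p zero = refl
shift-∘ q p (suc k) with p k
... | nothing = refl
... | just r  = refl

shift-inverse : ∀ {q p} → HalfInverse q p → HalfInverse (shift q) (shift p)
shift-inverse inv zero    zero    = (λ _ → refl) , (λ _ → refl)
shift-inverse {q} inv zero (suc l) = to , λ ()
  where
  to : M.map suc (q l) ≡ just zero → just zero ≡ just (suc l)
  to e with map-just (q l) e
  ... | _ , _ , ()
shift-inverse {q} {p} inv (suc k) zero = (λ ()) , from
  where
  from : M.map suc (p k) ≡ just zero → just zero ≡ just (suc k)
  from e with map-just (p k) e
  ... | _ , _ , ()
shift-inverse {q} {p} inv (suc k) (suc l) = to , from
  where
  to : M.map suc (q l) ≡ just (suc k) → M.map suc (p k) ≡ just (suc l)
  to e with map-just (q l) e
  ... | _ , e' , refl = cong (M.map suc) (proj₁ (inv k l) e')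
  from : M.map suc (p k) ≡ just (suc l) → M.map suc (q l) ≡ just (suc k)
  from e with map-just (p k) e
  ... | _ , e' , refl = cong (M.map suc) (proj₂ (inv k l) e')

lift-cong : ∀ {p q} → p ≗ q → lift p ≗ lift q
lift-cong e (+ zero)  = refl
lift-cong e (+ suc k) = cong (M.map _) (e k)
lift-cong e -[1+ k ]  = cong (M.map _) (e k)

lift-∘ : ∀ q p a → (lift q ∘ₚ lift p) a ≡ lift (q ∘ₕ p) a
lift-∘ q p (+ zero) = refl
lift-∘ q p (+ suc k) with p k
... | nothing = refl
... | just r  = refl
lift-∘ q p -[1+ k ] with p k
... | nothing = refl
... | just r  = refl

lift-neg : ∀ p a → lift p (- a) ≡ M.map -_ (lift p a)
lift-neg p (+ zero) = refl
lift-neg p (+ suc k) with p k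
... | nothing = refl
... | just r  = refl
lift-neg p -[1+ k ] with p k
... | nothing = refl
... | just r  = refl

lift-just : ∀ p a {b} → lift p a ≡ just b → Σ ℕ λ k → Σ ℕ λ l → p k ≡ just l ×
            ((a ≡ + suc k × b ≡ + suc l) ⊎ (a ≡ -[1+ k ] × b ≡ -[1+ l ]))
lift-just p (+ zero) ()
lift-just p (+ suc k) e with map-just (p k) e
... | l , e' , refl = k , l , e' , inj₁ (refl , refl)
lift-just p -[1+ k ] e with map-just (p k) e
... | l , e' , refl = k , l , e' , inj₂ (refl , refl)

lift-inverse : ∀ q p → HalfInverse q p → IsInverse (lift q) (lift p)
lift-inverse q p inv a b = to , from
  where
  to : lift q b ≡ just a → lift p a ≡ just b
  to e with lift-just q b e
  ... | l , k , e' , inj₁ (refl , refl) = cong (M.map _) (proj₁ (inv k l) e')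
  ... | l , k , e' , inj₂ (refl , refl) = cong (M.map _) (proj₁ (inv k l) e')
  from : lift p a ≡ just b → lift q b ≡ just a
  from e with lift-just p a e
  ... | k , l , e' , inj₁ (refl , refl) = cong (M.map _) (proj₂ (inv k l) e')
  ... | k , l , e' , inj₂ (refl , refl) = cong (M.map _) (proj₂ (inv k l) e')

-- The positive half of f_{j+2}: j ↦ j+1, j+1 undefined, every other point fixed.
fHalf : ℕ → HalfMap
fHalf zero    zero          = just 1
fHalf zero    (suc zero)    = nothing
fHalf zero    (suc (suc k)) = just (suc (suc k))
fHalf (suc j) k             = shift (fHalf j) k

gHalf : HalfMap
gHalf zero    = nothing
gHalf (suc k) = just k

genHalf : ∀ {n} → Gen n → HalfMap
genHalf (f (suc (suc j)) _ _)     = fHalf j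
genHalf (f (suc zero) (s≤s ()) _)
genHalf g                         = gHalf

-- The unrestricted action of a word (rightmost letter first).
actHalf : ∀ {n} → List (Gen n) → HalfMap
actHalf []      = just
actHalf (x ∷ w) = genHalf x ∘ₕ actHalf w

-- fHalf j described by the tests that fMap performs.
fHalf-tests : ∀ j k → fHalf j k ≡
  (if k ≡ᵇ suc j then nothing else if k ≡ᵇ j then just (suc j) else just k)
fHalf-tests zero    zero          = refl
fHalf-tests zero    (suc zero)    = refl
fHalf-tests zero    (suc (suc k)) = refl
fHalf-tests (suc j) zero          = refl
fHalf-tests (suc j) (suc k) with k ≡ᵇ suc j | k ≡ᵇ j | fHalf-tests j k
... | true  | _     | e = cong (M.map suc) e
... | false | true  | e = cong (M.map suc) e
... | false | false | e = cong (M.map suc) e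

fMap-lift : ∀ n j a → fMap n (suc (suc j)) a ≡ lift (restrict n (fHalf j)) a
fMap-lift n j (+ zero) = refl
fMap-lift n j (+ suc k) rewrite fHalf-tests j k with k <ᵇ n
... | false = refl
... | true with k ≡ᵇ suc j
...   | true = refl
...   | false with k ≡ᵇ j
...     | true  = refl
...     | false = refl
fMap-lift n j -[1+ k ] rewrite fHalf-tests j k with k <ᵇ n
... | false = refl
... | true with k ≡ᵇ suc j
...   | true = refl
...   | false with k ≡ᵇ j
...     | true  = refl
...     | false = refl

gMap-lift : ∀ n a → gMap n a ≡ lift (restrict n gHalf) a
gMap-lift n (+ zero) = refl
gMap-lift n (+ suc zero) with 0 <ᵇ n
... | false = refl
... | true  = refl
gMap-lift n (+ suc (suc k)) with suc k <ᵇ n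
... | false = refl
... | true  = refl
gMap-lift n -[1+ zero ] with 0 <ᵇ n
... | false = refl
... | true  = refl
gMap-lift n -[1+ suc k ] with suc k <ᵇ n
... | false = refl
... | true  = refl

idZ-lift : ∀ n a → idZ n a ≡ lift (restrict n just) a
idZ-lift n (+ zero) = refl
idZ-lift n (+ suc k) with k <ᵇ n
... | false = refl
... | true  = refl
idZ-lift n -[1+ k ] with k <ᵇ n
... | false = refl
... | true  = refl

genMap-lift : ∀ {n} (x : Gen n) a → genMap x a ≡ lift (restrict n (genHalf x)) a
genMap-lift {n} (f (suc (suc j)) _ _)     a = fMap-lift n j a
genMap-lift {n} (f (suc zero) (s≤s ()) _) a
genMap-lift {n} g                         a = gMap-lift n a

fHalf-value : ∀ j {k r} → fHalf j k ≡ just r → r ≡ k ⊎ r ≡ suc j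
fHalf-value zero    {zero}          refl = inj₂ refl
fHalf-value zero    {suc zero}      ()
fHalf-value zero    {suc (suc k)}   refl = inj₁ refl
fHalf-value (suc j) {zero}          refl = inj₁ refl
fHalf-value (suc j) {suc k}         e with map-just (fHalf j k) e
... | r , e' , refl with fHalf-value j e'
...   | inj₁ refl = inj₁ refl
...   | inj₂ refl = inj₂ refl

gen-bounded : ∀ {n} (x : Gen n) → Bounded n (genHalf x)
gen-bounded (f (suc (suc j)) _ j+2≤n) {k} k<n e with fHalf-value j e
... | inj₁ refl = k<n
... | inj₂ refl = j+2≤n
gen-bounded (f (suc zero) (s≤s ()) _)
gen-bounded g {suc k} k<n refl = ℕP.<-trans (ℕP.n<1+n k) k<n

act-bounded : ∀ {n} (w : List (Gen n)) → Bounded n (actHalf w)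
act-bounded []      k<n refl = k<n
act-bounded (x ∷ w) {k} k<n e with actHalf w k in e'
... | just r = gen-bounded x (act-bounded w k<n e') e

act-++ : ∀ {n} (u w : List (Gen n)) → actHalf (u ++ w) ≗ (actHalf u ∘ₕ actHalf w)
act-++ []      w k with actHalf w k
... | nothing = refl
... | just r  = refl
act-++ (x ∷ u) w k rewrite act-++ u w k with actHalf w k
... | nothing = refl
... | just r  = refl

evalWord-lift : ∀ n (w : List (Gen n)) a → evalWord n w a ≡ lift (restrict n (actHalf w)) a
evalWord-lift n []      a = idZ-lift n a
evalWord-lift n (x ∷ w) a = begin
    (evalWord n w a >>= genMap x)
  ≡⟨ cong (_>>= genMap x) (evalWord-lift n w a) ⟩
    (lift (restrict n (actHalf w)) a >>= genMap x)
  ≡⟨ bind-cong (lift (restrict n (actHalf w)) a) (genMap-lift x) ⟩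
    (lift (restrict n (actHalf w)) a >>= lift (restrict n (genHalf x)))
  ≡⟨ lift-∘ (restrict n (genHalf x)) (restrict n (actHalf w)) a ⟩
    lift (restrict n (genHalf x) ∘ₕ restrict n (actHalf w)) a
  ≡⟨ lift-cong (restrict-∘ n (genHalf x) (actHalf w) (act-bounded w)) a ⟩
    lift (restrict n (actHalf (x ∷ w))) a
  ∎
  where open ≡-Reasoning

Realised : ℕ → HalfMap → Set
Realised n p = Σ (List (Gen n)) λ w → restrict n (actHalf w) ≗ p

realised-InF : ∀ {n p} → Realised n p → InF n (lift p)
realised-InF {n} (w , e) = w , λ a → trans (evalWord-lift n w a) (lift-cong e a)

Realised-cong : ∀ {n p q} → p ≗ q → Realised n p → Realised n q
Realised-cong e (w , ew) = w , λ k → trans (ew k) (e k)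

Realised-∘ : ∀ {n p q} → Realised n p → Realised n q → Realised n (q ∘ₕ p)
Realised-∘ {n} {p} {q} (u , eu) (v , ev) = v ++ u , λ k → begin
    restrict n (actHalf (v ++ u)) k
  ≡⟨ restrict-cong n (act-++ v u) k ⟩
    restrict n (actHalf v ∘ₕ actHalf u) k
  ≡⟨ sym (restrict-∘ n (actHalf v) (actHalf u) (act-bounded u) k) ⟩
    (restrict n (actHalf u) k >>= restrict n (actHalf v))
  ≡⟨ cong (_>>= restrict n (actHalf v)) (eu k) ⟩
    (p k >>= restrict n (actHalf v))
  ≡⟨ bind-cong (p k) ev ⟩
    (p k >>= q)
  ∎
  where open ≡-Reasoning

HalfInverse-cong : ∀ {q p q' p'} → q ≗ q' → p ≗ p' → HalfInverse q p → HalfInverse q' p'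
HalfInverse-cong eq ep inv k l =
    (λ h → trans (sym (ep k)) (proj₁ (inv k l) (trans (eq l) h)))
  , (λ h → trans (sym (eq l)) (proj₂ (inv k l) (trans (ep k) h)))

HalfInverse-∘ : ∀ {q p q' p'} → HalfInverse q p → HalfInverse q' p' →
                HalfInverse (q ∘ₕ q') (p' ∘ₕ p)
HalfInverse-∘ {q} {p} {q'} {p'} inv inv' k l = to , from
  where
  to : (q' l >>= q) ≡ just k → (p k >>= p') ≡ just l
  to e with q' l in e'
  ... | just r rewrite proj₁ (inv k r) e = proj₁ (inv' r l) e'
  from : (p k >>= p') ≡ just l → (q' l >>= q) ≡ just k
  from e with p k in e'
  ... | just r rewrite proj₂ (inv' r l) e = proj₂ (inv k r) e'

Invertible : ℕ → HalfMap → Set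
Invertible n p = Realised n p × Σ HalfMap λ q → Realised n q × HalfInverse q p

Invertible-id : ∀ {n} → Invertible n (restrict n just)
Invertible-id {n} = ([] , λ _ → refl) , restrict n just , ([] , λ _ → refl) , λ k l → self l k , self k l
  where
  self : ∀ a b → restrict n just a ≡ just b → restrict n just b ≡ just a
  self a b e with restrict-just {n} just e
  ... | a<n , refl = e

Invertible-cong : ∀ {n p p'} → p ≗ p' → Invertible n p → Invertible n p'
Invertible-cong e (rp , q , rq , inv) = Realised-cong e rp , q , rq , HalfInverse-cong (λ _ → refl) e inv

Invertible-∘ : ∀ {n p p'} → Invertible n p → Invertible n p' → Invertible n (p' ∘ₕ p)
Invertible-∘ (rp , q , rq , inv) (rp' , q' , rq' , inv') =
  Realised-∘ rp rp' , q ∘ₕ q' , Realised-∘ rq' rq , HalfInverse-∘ inv inv'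

ins : ℕ → HalfMap
ins zero    k = just (suc k)
ins (suc x) k = shift (ins x) k

del : ℕ → HalfMap
del zero    k = gHalf k
del (suc x) k = shift (del x) k

ins-below : ∀ x {k} → k < x → ins x k ≡ just k
ins-below (suc x) {zero}  _         = refl
ins-below (suc x) {suc k} (s≤s k<x) = cong (M.map suc) (ins-below x k<x)

del-below : ∀ x {k} → k < x → del x k ≡ just k
del-below (suc x) {zero}  _         = refl
del-below (suc x) {suc k} (s≤s k<x) = cong (M.map suc) (del-below x k<x)

del-self : ∀ x → del x x ≡ nothing
del-self zero    = refl
del-self (suc x) = cong (M.map suc) (del-self x)

del-above : ∀ x {k} → x ≤ k → del x (suc k) ≡ just k
del-above zero    _         = refl
del-above (suc x) (s≤s x≤k) = cong (M.map suc) (del-above x x≤k)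

del-value : ∀ x {k l} → del x k ≡ just l → (k < x × l ≡ k) ⊎ (x ≤ l × k ≡ suc l)
del-value zero    {zero}  ()
del-value zero    {suc k} refl = inj₂ (z≤n , refl)
del-value (suc x) {zero}  refl = inj₁ (s≤s z≤n , refl)
del-value (suc x) {suc k} e with map-just (del x k) e
... | l , e' , refl with del-value x e'
...   | inj₁ (k<x , refl) = inj₁ (s≤s k<x , refl)
...   | inj₂ (x≤l , refl) = inj₂ (s≤s x≤l , refl)

ins-del-inverse : ∀ x → HalfInverse (ins x) (del x)
ins-del-inverse zero k l = to k , from k
  where
  to : ∀ k → just (suc l) ≡ just k → gHalf k ≡ just l
  to .(suc l) refl = refl
  from : ∀ k → gHalf k ≡ just l → just (suc l) ≡ just k
  from zero    ()
  from (suc k) refl = refl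
ins-del-inverse (suc x) = shift-inverse (ins-del-inverse x)

del-range : ∀ {N x k l} → x ≤ N → del x k ≡ just l → (k < suc N → l < N) × (l < N → k < suc N)
del-range {x = x} x≤N e with del-value x e
... | inj₁ (k<x , refl) = (λ _ → ℕP.<-≤-trans k<x x≤N) , ℕP.m<n⇒m<1+n
... | inj₂ (_ , refl)   = ℕP.≤-pred , s≤s

fHalf-next : ∀ j → fHalf j (suc j) ≡ nothing
fHalf-next zero    = refl
fHalf-next (suc j) = cong (M.map suc) (fHalf-next j)

fHalf-above : ∀ j {k} → suc (suc j) ≤ k → fHalf j k ≡ just k
fHalf-above zero    {suc zero}    (s≤s ())
fHalf-above zero    {suc (suc k)} _       = refl
fHalf-above (suc j) {suc k}       (s≤s h) = cong (M.map suc) (fHalf-above j h)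

fHalf-ins : ∀ x k → (ins (suc x) k >>= fHalf x) ≡ ins x k
fHalf-ins zero    zero    = refl
fHalf-ins zero    (suc k) = refl
fHalf-ins (suc x) k =
  trans (shift-∘ (fHalf x) (ins (suc x)) k) (shift-cong (fHalf-ins x) k)

up : ℕ → ℕ → HalfMap
up x zero    = fHalf x
up x (suc d) = fHalf x ∘ₕ up (suc x) d

up-below : ∀ x d {k} → k ≤ x + d → up x d k ≡ ins x k
up-below x zero {k} k≤x =
  trans (cong (_>>= fHalf x) (sym (ins-below (suc x) (s≤s (subst (k ≤_) (ℕP.+-identityʳ x) k≤x)))))
        (fHalf-ins x k)
up-below x (suc d) {k} k≤x+d =
  trans (cong (_>>= fHalf x) (up-below (suc x) d (subst (k ≤_) (ℕP.+-suc x d) k≤x+d)))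
        (fHalf-ins x k)

up-top : ∀ x d → up x d (suc (x + d)) ≡ nothing
up-top x zero    rewrite ℕP.+-identityʳ x = fHalf-next x
up-top x (suc d) rewrite ℕP.+-suc x d | up-top (suc x) d = refl

up-above : ∀ x d {k} → suc (suc (x + d)) ≤ k → up x d k ≡ just k
up-above x zero {k} h = fHalf-above x (subst (λ z → suc (suc z) ≤ k) (ℕP.+-identityʳ x) h)
up-above x (suc d) {k} h
  rewrite up-above (suc x) d (subst (λ z → suc (suc z) ≤ k) (ℕP.+-suc x d) h) =
  fHalf-above x (ℕP.≤-trans (s≤s (s≤s (ℕP.m≤m+n x (suc d)))) h)

-- Deleting x+1 is g ∘ f_2 ⋯ f_{x+2}: lift [0,x] up by one, then apply g.
del-via-up : ∀ x → (gHalf ∘ₕ up 0 x) ≗ del (suc x)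
del-via-up x k with ℕP.<-cmp k (suc x)
... | tri< k<x+1 _ _ = trans (cong (_>>= gHalf) (up-below 0 x (ℕP.≤-pred k<x+1)))
                             (sym (del-below (suc x) k<x+1))
... | tri≈ _ refl _  = trans (cong (_>>= gHalf) (up-top 0 x)) (sym (del-self (suc x)))
del-via-up x zero    | tri> _ _ ()
del-via-up x (suc k) | tri> _ _ (s≤s x<k) =
  trans (cong (_>>= gHalf) (up-above 0 x (s≤s x<k))) (sym (del-above (suc x) x<k))

fGen : ∀ {n} x → suc (suc x) ≤ n → Gen n
fGen x h = f (suc (suc x)) (s≤s (s≤s z≤n)) h

upWord : ∀ {n} x d → suc (suc (x + d)) ≤ n → List (Gen n)
upWord {n} x zero    h = fGen x (subst (λ z → suc (suc z) ≤ n) (ℕP.+-identityʳ x) h) ∷ []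
upWord {n} x (suc d) h = fGen x (ℕP.≤-trans (s≤s (s≤s (ℕP.m≤m+n x (suc d)))) h)
                       ∷ upWord (suc x) d (subst (λ z → suc (suc z) ≤ n) (ℕP.+-suc x d) h)

act-upWord : ∀ {n} x d (h : suc (suc (x + d)) ≤ n) → actHalf (upWord x d h) ≗ up x d
act-upWord x zero    h k = refl
act-upWord x (suc d) h k = cong (_>>= fHalf x) (act-upWord (suc x) d _ k)

delWord : ∀ {n} x → x < n → List (Gen n)
delWord zero    _ = g ∷ []
delWord (suc x) h = g ∷ upWord 0 x h

act-delWord : ∀ {n} x (h : x < n) → actHalf (delWord x h) ≗ del x
act-delWord zero    h k = refl
act-delWord (suc x) h k = trans (cong (_>>= gHalf) (act-upWord 0 x h k)) (del-via-up x k)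

-- The inverse of deleting x from [0,N+1) is realised: for x < N it is
-- f_{x+2} ⋯ f_{N+1}, and for x = N the deletion is its own inverse.
insertion-realised : ∀ N x → x ≤ N → Realised (suc N) (restrict N (ins x))
insertion-realised N x x≤N with ℕP.m≤n⇒m<n∨m≡n x≤N
... | inj₂ refl =
  Realised-cong (restrict-top x (del x) (ins x) (λ k<x → trans (del-below x k<x) (sym (ins-below x k<x)))
                              (del-self x))
                (delWord x (ℕP.n<1+n x) , restrict-cong (suc x) (act-delWord x (ℕP.n<1+n x)))
... | inj₁ x<N with ℕP.m≤n⇒∃[o]m+o≡n x<N
...   | d , refl =
  Realised-cong (restrict-top (suc (x + d)) (up x d) (ins x) (λ k<N → up-below x d (ℕP.≤-pred k<N)) (up-top x d))
                (upWord x d ℕP.≤-refl , restrict-cong (suc (suc (x + d))) (act-upWord x d ℕP.≤-refl))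

deletion-invertible : ∀ N x → x ≤ N → Invertible (suc N) (restrict (suc N) (del x))
deletion-invertible N x x≤N =
    (delWord x (s≤s x≤N) , restrict-cong (suc N) (act-delWord x (s≤s x≤N)))
  , restrict N (ins x) , insertion-realised N x x≤N
  , restrict-inverse N (suc N) (ins-del-inverse x) (del-range x≤N)

module Compression (S : ℕ → Bool) where

  rank : ℕ → ℕ
  rank zero    = zero
  rank (suc t) = if S t then suc (rank t) else rank t

  step : ℕ → HalfMap
  step t = if S t then just else del t

  -- Perform step (t-1), …, step 0 in this order.
  compress : ℕ → HalfMap
  compress zero    = just
  compress (suc t) = compress t ∘ₕ step t

  step-below : ∀ t {k} → k < t → step t k ≡ just k
  step-below t k<t with S t
  ... | true  = refl
  ... | false = del-below t k<t

  step-bounded : ∀ {n} t → Bounded n (step t)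
  step-bounded t k<n e with S t
  ... | true  = subst (_< _) (just-injective e) k<n
  ... | false with del-value t e
  ...   | inj₁ (_ , refl) = k<n
  ...   | inj₂ (_ , refl) = ℕP.<-trans (ℕP.n<1+n _) k<n

  compress-above : ∀ t r → compress t (t + r) ≡ just (rank t + r)
  compress-above zero    r = refl
  compress-above (suc t) r with S t
  ... | true  = trans (cong (compress t) (sym (ℕP.+-suc t r)))
                      (trans (compress-above t (suc r)) (cong just (ℕP.+-suc (rank t) r)))
  ... | false = trans (cong (_>>= compress t) (del-above t (ℕP.m≤m+n t r))) (compress-above t r)

  compress-at : ∀ k → compress (suc k) k ≡ (if S k then just (rank k) else nothing)
  compress-at k with S k
  ... | true  = trans (cong (compress k) (sym (ℕP.+-identityʳ k)))
                      (trans (compress-above k 0) (cong just (ℕP.+-identityʳ (rank k))))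
  ... | false = cong (_>>= compress k) (del-self k)

  compress-below : ∀ t {k} → k < t → compress t k ≡ (if S k then just (rank k) else nothing)
  compress-below (suc t) {k} (s≤s k≤t) with ℕP.m≤n⇒m<n∨m≡n k≤t
  ... | inj₁ k<t  = trans (cong (_>>= compress t) (step-below t k<t)) (compress-below t k<t)
  ... | inj₂ refl = compress-at k

  compress-member : ∀ t {k} → S k ≡ true → k < t → compress t k ≡ just (rank k)
  compress-member t {k} sk k<t =
    trans (compress-below t k<t) (cong (if_then just (rank k) else nothing) sk)

  step-invertible : ∀ {n} t → t < n → Invertible n (restrict n (step t))
  step-invertible {suc N} t (s≤s t≤N) with S t
  ... | true  = Invertible-id
  ... | false = deletion-invertible N t t≤N

  compress-invertible : ∀ {n} t → t ≤ n → Invertible n (restrict n (compress t))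
  compress-invertible zero    _   = Invertible-id
  compress-invertible {n} (suc t) t<n =
    Invertible-cong (restrict-∘ n (compress t) (step t) (step-bounded t))
      (Invertible-∘ (step-invertible t t<n) (compress-invertible t (ℕP.<⇒≤ t<n)))

  rank-mono : ∀ {k l} → k ≤ l → rank k ≤ rank l
  rank-mono {k} {zero} z≤n = z≤n
  rank-mono {k} {suc l} k≤l+1 with ℕP.m≤n⇒m<n∨m≡n k≤l+1
  ... | inj₂ refl = ℕP.≤-refl
  ... | inj₁ (s≤s k≤l) with S l
  ...   | true  = ℕP.m≤n⇒m≤1+n (rank-mono k≤l)
  ...   | false = rank-mono k≤l

  rank-strict : ∀ {k l} → S k ≡ true → k < l → rank k < rank l
  rank-strict {k} {l} sk k<l =
    subst (_≤ rank l) (cong (if_then suc (rank k) else rank k) sk) (rank-mono k<l)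

  rank-reflects : ∀ {k l} → S l ≡ true → rank k ≤ rank l → k ≤ l
  rank-reflects sl h = ℕP.≮⇒≥ (λ l<k → ℕP.<⇒≱ (rank-strict sl l<k) h)

  rank-onto : ∀ t {j} → j < rank t → Σ ℕ λ k → k < t × S k ≡ true × rank k ≡ j
  rank-onto zero    ()
  rank-onto (suc t) {j} j<r with S t in st
  ... | false with rank-onto t j<r
  ...   | k , k<t , sk , refl = k , ℕP.m≤n⇒m≤1+n k<t , sk , refl
  rank-onto (suc t) {j} j<r | true with ℕP.m≤n⇒m<n∨m≡n (ℕP.≤-pred j<r)
  ...   | inj₂ refl = t , ℕP.≤-refl , st , refl
  ...   | inj₁ j<r' with rank-onto t j<r'
  ...     | k , k<t , sk , refl = k , ℕP.m≤n⇒m≤1+n k<t , sk , refl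

  SignedMember : ℕ → ℤ → Set
  SignedMember t y = Σ ℕ λ k → k < t × S k ≡ true × (y ≡ + suc k ⊎ y ≡ -[1+ k ])

  signedList : ℕ → List ℤ
  signedList zero    = []
  signedList (suc t) = if S t then + suc t ∷ -[1+ t ] ∷ signedList t else signedList t

  signedList-sound : ∀ t {y} → y ∈ signedList t → SignedMember t y
  signedList-sound (suc t) p with S t in st
  signedList-sound (suc t) (here refl)         | true = t , ℕP.≤-refl , st , inj₁ refl
  signedList-sound (suc t) (there (here refl)) | true = t , ℕP.≤-refl , st , inj₂ refl
  signedList-sound (suc t) (there (there p))   | true with signedList-sound t p
  ... | k , k<t , sk , shape = k , ℕP.m≤n⇒m≤1+n k<t , sk , shape
  signedList-sound (suc t) p | false with signedList-sound t p
  ... | k , k<t , sk , shape = k , ℕP.m≤n⇒m≤1+n k<t , sk , shape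

  signedList-complete : ∀ t {y} → SignedMember t y → y ∈ signedList t
  signedList-complete (suc t) (k , s≤s k≤t , sk , shape) with ℕP.m≤n⇒m<n∨m≡n k≤t
  ... | inj₂ refl rewrite sk with shape
  ...   | inj₁ refl = here refl
  ...   | inj₂ refl = there (here refl)
  signedList-complete (suc t) (k , s≤s k≤t , sk , shape) | inj₁ k<t with S t
  ...   | true  = there (there (signedList-complete t (k , k<t , sk , shape)))
  ...   | false = signedList-complete t (k , k<t , sk , shape)

  signedList-length : ∀ t → length (signedList t) ≡ rank t + rank t
  signedList-length zero    = refl
  signedList-length (suc t) with S t
  ... | true  = cong suc (trans (cong suc (signedList-length t)) (sym (ℕP.+-suc (rank t) (rank t))))
  ... | false = signedList-length t

  signedList-unique : ∀ t → Unique (signedList t)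
  signedList-unique zero    = []
  signedList-unique (suc t) with S t
  ... | false = signedList-unique t
  ... | true  = All.tabulate fresh₊ ∷ All.tabulate fresh₋ ∷ signedList-unique t
    where
    fresh₊ : ∀ {y} → y ∈ -[1+ t ] ∷ signedList t → + suc t ≢ y
    fresh₊ (here refl) ()
    fresh₊ (there p) refl with signedList-sound t p
    ... | k , k<t , _ , inj₁ refl = ℕP.<-irrefl refl k<t
    fresh₋ : ∀ {y} → y ∈ signedList t → -[1+ t ] ≢ y
    fresh₋ p refl with signedList-sound t p
    ... | k , k<t , _ , inj₂ refl = ℕP.<-irrefl refl k<t

-- The Sugihara operations are defined from the order and negation, so a partial
-- map that commutes with negation and is an order embedding on a set C closed
-- under negation is injective on C and preserves all operations on C.
module OrderEmbedding
  (C : ℤ → Set) (φ : PMap)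
  (C-neg : ∀ {a} → C a → C (- a))
  (φ-neg : ∀ {a x} → φ a ≡ just x → φ (- a) ≡ just (- x))
  (φ-order : ∀ {a b x y} → C a → C b → φ a ≡ just x → φ b ≡ just y →
             (a ℤ.≤ b → x ℤ.≤ y) × (x ℤ.≤ y → a ℤ.≤ b))
  where

  injective : ∀ {a a' x} → C a → C a' → φ a ≡ just x → φ a' ≡ just x → a ≡ a'
  injective ca ca' e e' =
    ℤP.≤-antisym (proj₂ (φ-order ca ca' e e') ℤP.≤-refl) (proj₂ (φ-order ca' ca e' e) ℤP.≤-refl)

  hom-∧ : ∀ {a b x y} → C a → C b → φ a ≡ just x → φ b ≡ just y → φ (a ∧ˢ b) ≡ just (x ∧ˢ y)
  hom-∧ {a} {b} ca cb ea eb with ℤP.≤-total a b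
  ... | inj₁ a≤b rewrite ℤP.i≤j⇒i⊓j≡i a≤b | ℤP.i≤j⇒i⊓j≡i (proj₁ (φ-order ca cb ea eb) a≤b) = ea
  ... | inj₂ b≤a rewrite ℤP.i≥j⇒i⊓j≡j b≤a | ℤP.i≥j⇒i⊓j≡j (proj₁ (φ-order cb ca eb ea) b≤a) = eb

  hom-∨ : ∀ {a b x y} → C a → C b → φ a ≡ just x → φ b ≡ just y → φ (a ∨ˢ b) ≡ just (x ∨ˢ y)
  hom-∨ {a} {b} ca cb ea eb with ℤP.≤-total a b
  ... | inj₁ a≤b rewrite ℤP.i≤j⇒i⊔j≡j a≤b | ℤP.i≤j⇒i⊔j≡j (proj₁ (φ-order ca cb ea eb) a≤b) = eb
  ... | inj₂ b≤a rewrite ℤP.i≥j⇒i⊔j≡i b≤a | ℤP.i≥j⇒i⊔j≡i (proj₁ (φ-order cb ca eb ea) b≤a) = ea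

  -- a ⇒ b is (-a) ∨ b or (-a) ∧ b according to a ≤ b, and φ preserves that test.
  hom-⇒ : ∀ {a b x y} → C a → C b → φ a ≡ just x → φ b ≡ just y → φ (a ⇒ˢ b) ≡ just (x ⇒ˢ y)
  hom-⇒ {a} {b} {x} {y} ca cb ea eb with a ℤP.≤? b | x ℤP.≤? y
  ... | yes _   | yes _   = hom-∨ (C-neg ca) cb (φ-neg ea) eb
  ... | no _    | no _    = hom-∧ (C-neg ca) cb (φ-neg ea) eb
  ... | yes a≤b | no x≰y  = ⊥-elim (x≰y (proj₁ (φ-order ca cb ea eb) a≤b))
  ... | no a≰b  | yes x≤y = ⊥-elim (a≰b (proj₂ (φ-order ca cb ea eb) x≤y))

unique-length : ∀ (xs ys : List ℤ) → Unique xs → Unique ys →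
                (∀ {y} → y ∈ xs → y ∈ ys) → (∀ {y} → y ∈ ys → y ∈ xs) → length xs ≡ length ys
unique-length xs ys uxs uys to from = ↭-length (∼bag⇒↭ (unique∧set⇒bag uxs uys (mk⇔ to from)))

module CompressSubalgebra {n s : ℕ} (A : Subalgebra n s) where
  open Subalgebra A

  half : ℕ → Bool
  half k = does (+ suc k ∈? carrier)

  open Compression half public

  half-true : ∀ {k} → half k ≡ true → + suc k ∈ carrier
  half-true {k} e with + suc k ∈? carrier
  ... | yes p = p

  half-∈ : ∀ {k} → + suc k ∈ carrier → half k ≡ true
  half-∈ {k} p with + suc k ∈? carrier
  ... | yes _ = refl
  ... | no ¬p = ⊥-elim (¬p p)

  carrier-sound : ∀ {a} → a ∈ carrier → SignedMember n a
  carrier-sound {+ zero} p = ⊥-elim (proj₁ (All.lookup inside p) refl)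
  carrier-sound {+ suc k} p = k , proj₂ (All.lookup inside p) , half-∈ p , inj₁ refl
  carrier-sound { -[1+ k ]} p = k , proj₂ (All.lookup inside p) , half-∈ (closed-¬ p) , inj₂ refl

  carrier-complete : ∀ {a} → SignedMember n a → a ∈ carrier
  carrier-complete (k , _ , sk , inj₁ refl) = half-true sk
  carrier-complete (k , _ , sk , inj₂ refl) = closed-¬ (half-true sk)

  size-rank : rank n + rank n ≡ s
  size-rank = begin
      rank n + rank n
    ≡⟨ sym (signedList-length n) ⟩
      length (signedList n)
    ≡⟨ unique-length (signedList n) carrier (signedList-unique n) unique
         (λ p → carrier-complete (signedList-sound n p)) (λ p → signedList-complete n (carrier-sound p)) ⟩
      length carrier
    ≡⟨ size ⟩
      s
    ∎
    where open ≡-Reasoning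

  φ : PMap
  φ = lift (restrict n (compress n))

  signedRank : ℤ → ℤ
  signedRank (+ zero)  = + zero
  signedRank (+ suc k) = + suc (rank k)
  signedRank -[1+ k ]  = -[1+ rank k ]

  member-value : ∀ {k} → k < n → half k ≡ true → restrict n (compress n) k ≡ just (rank k)
  member-value k<n sk = trans (restrict-in (compress n) k<n) (compress-member n sk k<n)

  φ-value : ∀ {a} → a ∈ carrier → φ a ≡ just (signedRank a)
  φ-value p with carrier-sound p
  ... | k , k<n , sk , inj₁ refl = cong (M.map _) (member-value k<n sk)
  ... | k , k<n , sk , inj₂ refl = cong (M.map _) (member-value k<n sk)

  φ-neg : ∀ {a x} → φ a ≡ just x → φ (- a) ≡ just (- x)
  φ-neg {a} e = trans (lift-neg _ a) (cong (M.map -_) e)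

  -- rank is an order embedding on the positive half, so φ is an order embedding
  -- on A.
  signedRank-order : ∀ {a b} → a ∈ carrier → b ∈ carrier →
    (a ℤ.≤ b → signedRank a ℤ.≤ signedRank b) × (signedRank a ℤ.≤ signedRank b → a ℤ.≤ b)
  signedRank-order pa pb with carrier-sound pa | carrier-sound pb
  ... | k , _ , _ , inj₁ refl | l , _ , sl , inj₁ refl =
    (λ { (+≤+ (s≤s k≤l)) → +≤+ (s≤s (rank-mono k≤l)) }) ,
    (λ { (+≤+ (s≤s h)) → +≤+ (s≤s (rank-reflects sl h)) })
  ... | _ , _ , _ , inj₁ refl | _ , _ , _ , inj₂ refl = (λ ()) , (λ ())
  ... | _ , _ , _ , inj₂ refl | _ , _ , _ , inj₁ refl = (λ _ → -≤+) , (λ _ → -≤+)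
  ... | k , _ , sk , inj₂ refl | l , _ , _ , inj₂ refl =
    (λ { (-≤- l≤k) → -≤- (rank-mono l≤k) }) ,
    (λ { (-≤- h) → -≤- (rank-reflects sk h) })

  φ-order : ∀ {a b x y} → a ∈ carrier → b ∈ carrier → φ a ≡ just x → φ b ≡ just y →
            (a ℤ.≤ b → x ℤ.≤ y) × (x ℤ.≤ y → a ℤ.≤ b)
  φ-order pa pb ea eb
    rewrite just-injective (trans (sym ea) (φ-value pa)) | just-injective (trans (sym eb) (φ-value pb)) =
    signedRank-order pa pb

  open OrderEmbedding (_∈ carrier) φ closed-¬ (λ {a} → φ-neg {a}) φ-order

  φ-in-F : InF n φ
  φ-in-F = realised-InF (proj₁ (compress-invertible n ℕP.≤-refl))

  φ-inverse : Σ PMap λ ψ → InF n ψ × IsInverse ψ φ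
  φ-inverse with compress-invertible n ℕP.≤-refl
  ... | _ , q , q-realised , q-inverse = lift q , realised-InF q-realised , lift-inverse q _ q-inverse

  φ-iso : IsoOnto (rank n) φ A
  φ-iso = record
    { total      = λ p → signedRank _ , φ-value p , in-range p
    ; injective  = injective
    ; surjective = onto
    ; hom-∧      = hom-∧
    ; hom-∨      = hom-∨
    ; hom-¬      = λ {a} _ → φ-neg {a}
    ; hom-⇒      = hom-⇒
    }
    where
    in-range : ∀ {a} → a ∈ carrier → InZ (rank n) (signedRank a)
    in-range p with carrier-sound p
    ... | k , k<n , sk , inj₁ refl = (λ ()) , rank-strict sk k<n
    ... | k , k<n , sk , inj₂ refl = (λ ()) , rank-strict sk k<n
    onto : ∀ {b} → InZ (rank n) b → Σ ℤ λ a → a ∈ carrier × φ a ≡ just b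
    onto {+ zero} (b≢0 , _) = ⊥-elim (b≢0 refl)
    onto {+ suc j} (_ , j<r) with rank-onto n j<r
    ... | k , k<n , sk , refl = + suc k , half-true sk , φ-value (half-true sk)
    onto { -[1+ j ]} (_ , j<r) with rank-onto n j<r
    ... | k , k<n , sk , refl = -[1+ k ] , closed-¬ (half-true sk) , φ-value (closed-¬ (half-true sk))

proposition2p7 : (n : ℕ) → 1 ≤ n → (m : ℕ) → m ≤ n → (A : Subalgebra n (2 * m)) →
    Σ PMap λ φ → InF n φ × IsoOnto m φ A × Σ PMap (λ ψ → InF n ψ × IsInverse ψ φ)
proposition2p7 n _ m _ A = φ , φ-in-F , subst (λ r → IsoOnto r φ A) rank≡m φ-iso , φ-inverse
  where
  open CompressSubalgebra A
  rank≡m : rank n ≡ m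
  rank≡m = ℕP.*-cancelˡ-≡ (rank n) m 2 (trans (cong (λ r → rank n + r) (ℕP.+-identityʳ (rank n))) size-rank)
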